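{- For every integer $r\geq 2$, if $1\leq k<\lfloor r/e\rfloor$, then there exists $(x_1,\ldots,x_r)\in\mathcal{X}_{r,k}$ with $\prod_{i=1}^r x_i>r!/r^r$.
   Context: For $1\leq k\leq\lfloor r/2\rfloor$, $\mathcal{X}_{r,k}$ is the set of $(x_1,\ldots,x_r)\in\mathbb{R}^r$ with $0<x_1\leq\cdots\leq x_r=1$ and $x_i+x_j\leq x_{i+j}$ for every $i\in\{1,\ldots,k\}$ and every integer $j$ with $i\leq j\leq r-i$. -}

module Defs where

open import Data.Nat as ℕ using (ℕ; zero; suc; _!; _^_)
open import Data.Nat.Properties using (_!≢0; m^n≢0)
open import Data.Integer using (+_)
open import Data.Rational using (ℚ; _+_; _*_; _≤_; _<_; 0ℚ; 1ℚ; _/_)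
open import Relation.Binary.PropositionalEquality using (_≡_)

-- A point of R^r is represented by x : ℕ → ℚ, of which only the
-- values x 1, …, x r (1-based, as in the paper) are used.

eSum : ℕ → ℚ
eSum zero    = _/_ (+ 1) (zero !) {{zero !≢0}}
eSum (suc N) = eSum N + _/_ (+ 1) (suc N !) {{suc N !≢0}}

-- e ≤ q  (e is the supremum of the increasing partial sums eSum N)
e≤ : ℚ → Set
e≤ q = ∀ N → eSum N ≤ q

prod : (ℕ → ℚ) → ℕ → ℚ
prod x zero    = 1ℚ
prod x (suc n) = prod x n * x (suc n)

-- r! / r^r  (value at r = 0 is irrelevant: only used for r ≥ 2)
factOverPow : ℕ → ℚ
factOverPow zero    = 1ℚ
factOverPow (suc n) = _/_ (+ (suc n !)) (suc n ^ suc n) {{m^n≢0 (suc n) (suc n)}}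

record InX (r k : ℕ) (x : ℕ → ℚ) : Set where
  field
    pos     : 0ℚ < x 1
    mono    : ∀ i → 1 ℕ.≤ i → i ℕ.< r → x i ≤ x (suc i)
    last    : x r ≡ 1ℚ
    superadd : ∀ i j → 1 ℕ.≤ i → i ℕ.≤ k → i ℕ.≤ j → j ℕ.≤ r ℕ.∸ i →
               x i + x j ≤ x (i ℕ.+ j)

{-# OPTIONS --safe #-}
-- The witness is x_i = i/(r+1) for i ≤ k and x_i = (i+1)/(r+1) for i > k.
-- Superadditivity is only required for i ≤ k, where x_i = i/(r+1), so it holds because
-- (r+1) x_j - j is nondecreasing in j.  Moreover ∏ x_i = r! (r+1) / ((k+1) (r+1)^r), which
-- exceeds r!/r^r iff (k+1) (1+1/r)^(r-1) < r.  This follows from the hypothesis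
-- Σ_{j<r} 1/j! ≤ e ≤ r/(k+1) and the binomial bound (1+1/n)^m < Σ_{j≤m} 1/j! for 1 ≤ m < n.
-- Clearing denominators, the latter compares values of P(a) = Σ_{j≤m} (m!/j!) n^(m-j) a^j:
-- (n+1)^m m! ≤ P(m) < P(n) = n^m Σ_{j≤m} m!/j!.
module Submission where

open import Defs
open import Data.Nat using (ℕ; _≤_; suc)
open import Data.Integer using (+_)
open import Data.Rational using (ℚ; _<_; _/_)
open import Data.Product using (Σ; _×_)

open import Data.Nat as ℕ using (zero; _+_; _*_; _^_; _!; z≤n; s≤s; NonZero)
open import Data.Nat.Properties
open import Data.Nat.Tactic.RingSolver using (solve-∀)
import Data.Integer.Base as ℤ
import Data.Integer.Properties as ℤ
import Data.Rational as ℚ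
import Data.Rational.Properties as ℚ
open import Data.Rational.Unnormalised as ℚᵘ using (mkℚᵘ; *≡*; *≤*; *<*)
  renaming (_/_ to _/ᵘ_; _≃_ to _≃ᵘ_)
import Data.Rational.Unnormalised.Properties as ℚᵘ
open import Data.Product using (_,_)
open import Data.Sum using (inj₁; inj₂)
open import Relation.Binary.PropositionalEquality

infixl 7 _÷_
_÷_ : ℕ → (d : ℕ) → .{{NonZero d}} → ℚ
a ÷ d = + a / d

private
  toℚᵘ-÷ : ∀ a d .{{_ : NonZero d}} → ℚ.toℚᵘ (a ÷ d) ≃ᵘ (+ a /ᵘ d)
  toℚᵘ-÷ a (suc d) = ℚ.toℚᵘ-fromℚᵘ (mkℚᵘ (+ a) d)

÷-cong : ∀ {a b c d} .{{_ : NonZero b}} .{{_ : NonZero d}} → a * d ≡ c * b → a ÷ b ≡ c ÷ d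
÷-cong {a} {b@(suc _)} {c} {d@(suc _)} ad≡cb =
  ℚ.toℚᵘ-injective (ℚᵘ.≃-trans (toℚᵘ-÷ a b) (ℚᵘ.≃-trans
    (*≡* (trans (sym (ℤ.pos-* a d)) (trans (cong +_ ad≡cb) (ℤ.pos-* c b))))
    (ℚᵘ.≃-sym (toℚᵘ-÷ c d))))

÷-mono-≤ : ∀ {a b c d} .{{_ : NonZero b}} .{{_ : NonZero d}} → a * d ≤ c * b → a ÷ b ℚ.≤ c ÷ d
÷-mono-≤ {a} {b@(suc _)} {c} {d@(suc _)} ad≤cb = ℚ.toℚᵘ-cancel-≤
  (ℚᵘ.≤-respˡ-≃ (ℚᵘ.≃-sym (toℚᵘ-÷ a b)) (ℚᵘ.≤-respʳ-≃ (ℚᵘ.≃-sym (toℚᵘ-÷ c d))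
    (*≤* (subst₂ ℤ._≤_ (ℤ.pos-* a d) (ℤ.pos-* c b) (ℤ.+≤+ ad≤cb)))))

÷-cancel-≤ : ∀ {a b c d} .{{_ : NonZero b}} .{{_ : NonZero d}} → a ÷ b ℚ.≤ c ÷ d → a * d ≤ c * b
÷-cancel-≤ {a} {b@(suc _)} {c} {d@(suc _)} a/b≤c/d
  with ℚᵘ.≤-respˡ-≃ (toℚᵘ-÷ a b) (ℚᵘ.≤-respʳ-≃ (toℚᵘ-÷ c d) (ℚ.toℚᵘ-mono-≤ a/b≤c/d))
... | *≤* ad≤cb = ℤ.drop‿+≤+ (subst₂ ℤ._≤_ (sym (ℤ.pos-* a d)) (sym (ℤ.pos-* c b)) ad≤cb)

÷-mono-< : ∀ {a b c d} .{{_ : NonZero b}} .{{_ : NonZero d}} → a * d ℕ.< c * b → a ÷ b < c ÷ d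
÷-mono-< {a} {b@(suc _)} {c} {d@(suc _)} ad<cb = ℚ.toℚᵘ-cancel-<
  (ℚᵘ.<-respˡ-≃ (ℚᵘ.≃-sym (toℚᵘ-÷ a b)) (ℚᵘ.<-respʳ-≃ (ℚᵘ.≃-sym (toℚᵘ-÷ c d))
    (*<* (subst₂ ℤ._<_ (ℤ.pos-* a d) (ℤ.pos-* c b) (ℤ.+<+ ad<cb)))))

÷-+-÷ : ∀ {a b c d} .{{_ : NonZero b}} .{{_ : NonZero d}} →
        a ÷ b ℚ.+ c ÷ d ≡ ((a * d + c * b) ÷ (b * d)) {{m*n≢0 b d}}
÷-+-÷ {a} {b@(suc _)} {c} {d@(suc _)} =
  ℚ.toℚᵘ-injective (ℚᵘ.≃-trans (ℚ.toℚᵘ-homo-+ (a ÷ b) (c ÷ d))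
    (ℚᵘ.≃-trans (ℚᵘ.+-cong (toℚᵘ-÷ a b) (toℚᵘ-÷ c d))
    (ℚᵘ.≃-trans (ℚᵘ.≃-reflexive (cong (λ n → mkℚᵘ n _)
      (trans (cong₂ ℤ._+_ (sym (ℤ.pos-* a d)) (sym (ℤ.pos-* c b))) (sym (ℤ.pos-+ (a * d) (c * b))))))
    (ℚᵘ.≃-sym (toℚᵘ-÷ _ (b * d) {{m*n≢0 b d}})))))

÷-*-÷ : ∀ {a b c d} .{{_ : NonZero b}} .{{_ : NonZero d}} →
        (a ÷ b) ℚ.* (c ÷ d) ≡ ((a * c) ÷ (b * d)) {{m*n≢0 b d}}
÷-*-÷ {a} {b@(suc _)} {c} {d@(suc _)} =
  ℚ.toℚᵘ-injective (ℚᵘ.≃-trans (ℚ.toℚᵘ-homo-* (a ÷ b) (c ÷ d))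
    (ℚᵘ.≃-trans (ℚᵘ.*-cong (toℚᵘ-÷ a b) (toℚᵘ-÷ c d))
    (ℚᵘ.≃-trans (ℚᵘ.≃-reflexive (cong (λ n → mkℚᵘ n _) (sym (ℤ.pos-* a c))))
    (ℚᵘ.≃-sym (toℚᵘ-÷ _ (b * d) {{m*n≢0 b d}})))))

÷-+-÷-sameDenominator : ∀ {a c d} .{{_ : NonZero d}} → a ÷ d ℚ.+ c ÷ d ≡ (a + c) ÷ d
÷-+-÷-sameDenominator {a} {c} {d} =
  trans (÷-+-÷ {a} {d} {c} {d}) (÷-cong {a * d + c * d} {d * d} {a + c} {d} {{m*n≢0 d d}} (identity a c d))
  where
    identity : ∀ a c d → (a * d + c * d) * d ≡ (a + c) * (d * d)
    identity = solve-∀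

*-cancelˡ-÷ : ∀ {a d} k .{{_ : NonZero k}} .{{_ : NonZero d}} → ((k * a) ÷ (k * d)) {{m*n≢0 k d}} ≡ a ÷ d
*-cancelˡ-÷ {a} {d} k = ÷-cong {k * a} {k * d} {a} {d} {{m*n≢0 k d}} (identity k a d)
  where
    identity : ∀ k a d → k * a * d ≡ a * (k * d)
    identity = solve-∀

arrangements : ℕ → ℕ
arrangements zero    = 1
arrangements (suc n) = suc n * arrangements n + 1

eSum≡arrangements÷! : ∀ n → eSum n ≡ (arrangements n ÷ n !) {{n !≢0}}
eSum≡arrangements÷! zero    = refl
eSum≡arrangements÷! (suc n) = begin
  eSum n ℚ.+ 1 ÷ suc n !                           ≡⟨ cong (ℚ._+ 1 ÷ suc n !) (eSum≡arrangements÷! n) ⟩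
  arrangements n ÷ n ! ℚ.+ 1 ÷ suc n !             ≡⟨ cong (ℚ._+ 1 ÷ suc n !) (*-cancelˡ-÷ {A} {n !} (suc n)) ⟨
  suc n * A ÷ suc n ! ℚ.+ 1 ÷ suc n !              ≡⟨ ÷-+-÷-sameDenominator {suc n * A} {1} {suc n !} ⟩
  arrangements (suc n) ÷ suc n !                   ∎
  where
    open ≡-Reasoning
    A = arrangements n
    instance
      n!≢0 : NonZero (n !)
      n!≢0 = n !≢0
      [n+1]!≢0 : NonZero (suc n !)
      [n+1]!≢0 = suc n !≢0

bernoulli : ∀ a p → a ^ suc p + suc p * a ^ p ≤ suc a ^ suc p
bernoulli a zero    = ≤-reflexive (identity a)
  where
    identity : ∀ a → a * 1 + 1 * 1 ≡ (1 + a) * 1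
    identity = solve-∀
bernoulli a (suc p) = begin
  a ^ suc (suc p) + suc (suc p) * a ^ suc p                  ≤⟨ m≤m+n _ _ ⟩
  a ^ suc (suc p) + suc (suc p) * a ^ suc p + suc p * a ^ p ≡⟨ identity a (a ^ p) p ⟩
  suc a * (a ^ suc p + suc p * a ^ p)                         ≤⟨ *-monoʳ-≤ (suc a) (bernoulli a p) ⟩
  suc a ^ suc (suc p)                                         ∎
  where
    open ≤-Reasoning
    identity : ∀ a aᵖ p → a * (a * aᵖ) + (2 + p) * (a * aᵖ) + (1 + p) * aᵖ ≡ (1 + a) * (a * aᵖ + (1 + p) * aᵖ)
    identity = solve-∀

module _ (n : ℕ) where

  -- expPoly m a = Σ_{j ≤ m} (m!/j!) n^(m-j) a^j = m! n^m Σ_{j ≤ m} (a/n)^j / j!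
  expPoly : ℕ → ℕ → ℕ
  expPoly zero    a = 1
  expPoly (suc m) a = suc m * n * expPoly m a + a ^ suc m

  expPoly-monoʳ-≤ : ∀ m {a b} → a ≤ b → expPoly m a ≤ expPoly m b
  expPoly-monoʳ-≤ zero    a≤b = ≤-refl
  expPoly-monoʳ-≤ (suc m) a≤b =
    +-mono-≤ (*-monoʳ-≤ (suc m * n) (expPoly-monoʳ-≤ m a≤b)) (^-monoˡ-≤ (suc m) a≤b)

  expPoly-monoʳ-< : ∀ m {a b} → a ℕ.< b → expPoly (suc m) a ℕ.< expPoly (suc m) b
  expPoly-monoʳ-< m a<b =
    +-mono-≤-< (*-monoʳ-≤ (suc m * n) (expPoly-monoʳ-≤ m (<⇒≤ a<b))) (^-monoˡ-< (suc m) a<b)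

  expPoly-at-n : ∀ m → expPoly m n ≡ n ^ m * arrangements m
  expPoly-at-n zero    = refl
  expPoly-at-n (suc m) = begin
    suc m * n * expPoly m n + n ^ suc m            ≡⟨ cong (λ e → suc m * n * e + n ^ suc m) (expPoly-at-n m) ⟩
    suc m * n * (n ^ m * arrangements m) + n ^ suc m ≡⟨ identity (suc m) n (n ^ m) (arrangements m) ⟩
    n ^ suc m * arrangements (suc m)               ∎
    where
      open ≡-Reasoning
      identity : ∀ s n nᵐ A → s * n * (nᵐ * A) + n * nᵐ ≡ n * nᵐ * (s * A + 1)
      identity = solve-∀

  -- The forward difference in a dominates the derivative ∂ₐ expPoly (suc m) a = suc m * expPoly m a.
  expPoly-forwardDifference : ∀ m a → expPoly (suc m) a + suc m * expPoly m a ≤ expPoly (suc m) (suc a)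
  expPoly-forwardDifference zero    a = ≤-reflexive (identity n a)
    where
      identity : ∀ n a → 1 * n * 1 + a * 1 + 1 * 1 ≡ 1 * n * 1 + (1 + a) * 1
      identity = solve-∀
  expPoly-forwardDifference (suc m) a = begin
    expPoly (2 + m) a + (2 + m) * expPoly (suc m) a
      ≡⟨ identity (2 + m) (suc m) n (expPoly (suc m) a) (expPoly m a) (a ^ suc m) (a ^ (2 + m)) ⟩
    (2 + m) * n * (expPoly (suc m) a + suc m * expPoly m a) + (a ^ (2 + m) + (2 + m) * a ^ suc m)
      ≤⟨ +-mono-≤ (*-monoʳ-≤ ((2 + m) * n) (expPoly-forwardDifference m a)) (bernoulli a (suc m)) ⟩
    expPoly (2 + m) (suc a)
      ∎
    where
      open ≤-Reasoning
      identity : ∀ s t n E E′ P Q → s * n * E + Q + s * (t * n * E′ + P) ≡ s * n * (E + t * E′) + (Q + s * P)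
      identity = solve-∀

  [1+n]^m*m!≤expPoly[m] : ∀ m → suc n ^ m * m ! ≤ expPoly m m
  [1+n]^m*m!≤expPoly[m] zero    = ≤-refl
  [1+n]^m*m!≤expPoly[m] (suc m) = begin
    suc n ^ suc m * suc m !                    ≡⟨ identity (suc m) n (suc n ^ m) (m !) ⟩
    suc m * suc n * (suc n ^ m * m !)          ≤⟨ *-monoʳ-≤ (suc m * suc n) ([1+n]^m*m!≤expPoly[m] m) ⟩
    suc m * suc n * expPoly m m                ≡⟨ distrib (suc m) n (expPoly m m) ⟩
    suc m * n * expPoly m m + suc m * expPoly m m
      ≤⟨ +-monoˡ-≤ (suc m * expPoly m m) (m≤m+n (suc m * n * expPoly m m) (m ^ suc m)) ⟩
    expPoly (suc m) m + suc m * expPoly m m    ≤⟨ expPoly-forwardDifference m m ⟩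
    expPoly (suc m) (suc m)                    ∎
    where
      open ≤-Reasoning
      identity : ∀ s n r f → (1 + n) * r * (s * f) ≡ s * (1 + n) * (r * f)
      identity = solve-∀
      distrib : ∀ s n e → s * (1 + n) * e ≡ s * n * e + s * e
      distrib = solve-∀

[1+1/n]^m<eSum[m] : ∀ {m n} → suc m ℕ.< n → suc n ^ suc m * suc m ! ℕ.< n ^ suc m * arrangements (suc m)
[1+1/n]^m<eSum[m] {m} {n} m+1<n = begin-strict
  suc n ^ suc m * suc m !          ≤⟨ [1+n]^m*m!≤expPoly[m] n (suc m) ⟩
  expPoly n (suc m) (suc m)        <⟨ expPoly-monoʳ-< n m m+1<n ⟩
  expPoly n (suc m) n              ≡⟨ expPoly-at-n n (suc m) ⟩
  n ^ suc m * arrangements (suc m) ∎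
  where open ≤-Reasoning

above : ℕ → ℕ → ℕ
above k       zero    = 0
above zero    (suc i) = 1
above (suc k) (suc i) = above k i

above-≤ : ∀ {k i} → i ≤ k → above k i ≡ 0
above-≤ {k}     {zero}  _         = refl
above-≤ {suc k} {suc i} (s≤s i≤k) = above-≤ i≤k

above-> : ∀ {k i} → k ℕ.< i → above k i ≡ 1
above-> {zero}  {suc i} _         = refl
above-> {suc k} {suc i} (s≤s k<i) = above-> k<i

above-mono : ∀ k {i j} → i ≤ j → above k i ≤ above k j
above-mono k       {zero}            _         = z≤n
above-mono zero    {suc i} {suc j} _         = ≤-refl
above-mono (suc k) {suc i} {suc j} (s≤s i≤j) = above-mono k i≤j

gapped : ℕ → ℕ → ℕ
gapped k i = i + above k i

gapped-≤ : ∀ {k i} → i ≤ k → gapped k i ≡ i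
gapped-≤ {k} {i} i≤k = trans (cong (_+_ i) (above-≤ i≤k)) (+-identityʳ i)

gapped-> : ∀ {k i} → k ℕ.< i → gapped k i ≡ suc i
gapped-> {k} {i} k<i = trans (cong (_+_ i) (above-> k<i)) (+-comm i 1)

gapped-mono : ∀ k {i j} → i ≤ j → gapped k i ≤ gapped k j
gapped-mono k i≤j = +-mono-≤ i≤j (above-mono k i≤j)

gapped-superadditive : ∀ {k i} j → i ≤ k → gapped k i + gapped k j ≤ gapped k (i + j)
gapped-superadditive {k} {i} j i≤k = begin
  gapped k i + gapped k j  ≡⟨ cong (_+ gapped k j) (gapped-≤ i≤k) ⟩
  i + (j + above k j)      ≡⟨ +-assoc i j (above k j) ⟨
  i + j + above k j        ≤⟨ +-monoʳ-≤ (i + j) (above-mono k (m≤n+m j i)) ⟩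
  gapped k (i + j)         ∎
  where open ≤-Reasoning

∏ : (ℕ → ℕ) → ℕ → ℕ
∏ f zero    = 1
∏ f (suc n) = ∏ f n * f (suc n)

∏-gapped≡! : ∀ {k} n → n ≤ k → ∏ (gapped k) n ≡ n !
∏-gapped≡! zero    _     = refl
∏-gapped≡! (suc n) n<k = trans (cong₂ _*_ (∏-gapped≡! n (<⇒≤ n<k)) (gapped-≤ n<k)) (*-comm (n !) (suc n))

∏-gapped*[k+1]≡[n+1]! : ∀ {k} n → k ≤ n → ∏ (gapped k) n * suc k ≡ suc n !
∏-gapped*[k+1]≡[n+1]! {k} n k≤n with m≤n⇒m<n∨m≡n k≤n
... | inj₂ refl = trans (cong (_* suc k) (∏-gapped≡! k ≤-refl)) (*-comm (k !) (suc k))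
∏-gapped*[k+1]≡[n+1]! {k} (suc n) _ | inj₁ (s≤s k≤n) = begin
  ∏ (gapped k) n * gapped k (suc n) * suc k  ≡⟨ cong (λ g → ∏ (gapped k) n * g * suc k) (gapped-> (s≤s k≤n)) ⟩
  ∏ (gapped k) n * suc (suc n) * suc k       ≡⟨ swap (∏ (gapped k) n) (suc (suc n)) (suc k) ⟩
  ∏ (gapped k) n * suc k * suc (suc n)       ≡⟨ cong (_* suc (suc n)) (∏-gapped*[k+1]≡[n+1]! n k≤n) ⟩
  suc n ! * suc (suc n)                      ≡⟨ *-comm (suc n !) (suc (suc n)) ⟩
  suc (suc n) !                              ∎
  where
    open ≡-Reasoning
    swap : ∀ a b c → a * b * c ≡ a * c * b
    swap = solve-∀

÷-monoˡ-≤ : ∀ {a c d} .{{_ : NonZero d}} → a ≤ c → a ÷ d ℚ.≤ c ÷ d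
÷-monoˡ-≤ {a} {c} {d} a≤c = ÷-mono-≤ {a} {d} {c} {d} (*-monoˡ-≤ d a≤c)

prod-÷ : ∀ f d n .{{_ : NonZero d}} → prod (λ i → f i ÷ d) n ≡ (∏ f n ÷ d ^ n) {{m^n≢0 d n}}
prod-÷ f d zero    = refl
prod-÷ f d (suc n) = begin
  prod (λ i → f i ÷ d) n ℚ.* (f (suc n) ÷ d) ≡⟨ cong (ℚ._* (f (suc n) ÷ d)) (prod-÷ f d n) ⟩
  (∏ f n ÷ d ^ n) ℚ.* (f (suc n) ÷ d)        ≡⟨ ÷-*-÷ {∏ f n} {d ^ n} {f (suc n)} {d} ⟩
  ∏ f (suc n) ÷ (d ^ n * d)                  ≡⟨ ÷-cong {∏ f (suc n)} {d ^ n * d} {∏ f (suc n)} {d ^ suc n}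
                                                  (cong (_*_ (∏ f (suc n))) (*-comm d (d ^ n))) ⟩
  ∏ f (suc n) ÷ d ^ suc n                    ∎
  where
    open ≡-Reasoning
    instance
      dⁿ≢0 : NonZero (d ^ n)
      dⁿ≢0 = m^n≢0 d n
      dⁿ⁺¹≢0 : NonZero (d ^ suc n)
      dⁿ⁺¹≢0 = m^n≢0 d (suc n)
      dⁿd≢0 : NonZero (d ^ n * d)
      dⁿd≢0 = m*n≢0 (d ^ n) d

witness : ℕ → ℕ → ℕ → ℚ
witness r k i = gapped k i ÷ suc r

witness∈X : ∀ {r k} → k ℕ.< r → InX r k (witness r k)
witness∈X {r} {k} k<r = record
  { pos      = ÷-mono-< {0} {1} {gapped k 1} {suc r} (s≤s z≤n)
  ; mono     = λ i _ _ → ÷-monoˡ-≤ (gapped-mono k (n≤1+n i))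
  ; last     = trans (cong (_÷ suc r) (gapped-> k<r)) (÷-cong {suc r} {suc r} {1} {1} (*-comm (suc r) 1))
  ; superadd = λ i j _ i≤k _ _ → ℚ.≤-trans
      (ℚ.≤-reflexive (÷-+-÷-sameDenominator {gapped k i} {gapped k j} {suc r}))
      (÷-monoˡ-≤ (gapped-superadditive j i≤k))
  }

e≤÷⇒arrangements*≤ : ∀ {a b} .{{_ : NonZero b}} → e≤ (a ÷ b) → ∀ n → arrangements n * b ≤ a * n !
e≤÷⇒arrangements*≤ {a} {b} e≤a/b n = ÷-cancel-≤ {arrangements n} {n !} {a} {b} {{n !≢0}}
  (subst (ℚ._≤ a ÷ b) (eSum≡arrangements÷! n) (e≤a/b n))

[k+1][r+1]^[r-1]<r^r : ∀ {m k} → arrangements (suc m) * suc k ≤ (2 + m) * suc m ! →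
                       suc k * (3 + m) ^ suc m ℕ.< (2 + m) ^ (2 + m)
[k+1][r+1]^[r-1]<r^r {m} {k} bound = *-cancelʳ-< (suc m !) _ _ (begin-strict
  suc k * (3 + m) ^ suc m * suc m !                ≡⟨ *-assoc (suc k) ((3 + m) ^ suc m) (suc m !) ⟩
  suc k * ((3 + m) ^ suc m * suc m !)              <⟨ *-monoʳ-< (suc k) ([1+1/n]^m<eSum[m] {m} ≤-refl) ⟩
  suc k * ((2 + m) ^ suc m * arrangements (suc m)) ≡⟨ rearrange (suc k) ((2 + m) ^ suc m) (arrangements (suc m)) ⟩
  (2 + m) ^ suc m * (arrangements (suc m) * suc k) ≤⟨ *-monoʳ-≤ ((2 + m) ^ suc m) bound ⟩
  (2 + m) ^ suc m * ((2 + m) * suc m !)            ≡⟨ rearrange′ ((2 + m) ^ suc m) (2 + m) (suc m !) ⟩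
  (2 + m) ^ (2 + m) * suc m !                      ∎)
  where
    open ≤-Reasoning
    rearrange : ∀ k p a → k * (p * a) ≡ p * (a * k)
    rearrange = solve-∀
    rearrange′ : ∀ p r f → p * (r * f) ≡ r * p * f
    rearrange′ = solve-∀

r!*[r+1]^r<∏gapped*r^r : ∀ {m k} → k ≤ 2 + m → arrangements (suc m) * suc k ≤ (2 + m) * suc m ! →
                          (2 + m) ! * (3 + m) ^ (2 + m) ℕ.< ∏ (gapped k) (2 + m) * (2 + m) ^ (2 + m)
r!*[r+1]^r<∏gapped*r^r {m} {k} k≤r bound = *-cancelʳ-< (suc k) _ _ (begin-strict
  r ! * suc r ^ r * suc k                ≡⟨ rearrange (r !) (suc r) (suc r ^ suc m) (suc k) ⟩
  r ! * suc r * (suc k * suc r ^ suc m)  <⟨ *-monoʳ-< (r ! * suc r) {{r![r+1]≢0}} ([k+1][r+1]^[r-1]<r^r {m} bound) ⟩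
  r ! * suc r * r ^ r                    ≡⟨ cong (_* r ^ r) (*-comm (r !) (suc r)) ⟩
  suc r ! * r ^ r                        ≡⟨ cong (_* r ^ r) (∏-gapped*[k+1]≡[n+1]! r k≤r) ⟨
  ∏ (gapped k) r * suc k * r ^ r         ≡⟨ rearrange′ (∏ (gapped k) r) (suc k) (r ^ r) ⟩
  ∏ (gapped k) r * r ^ r * suc k         ∎)
  where
    open ≤-Reasoning
    r = 2 + m
    r![r+1]≢0 : NonZero (r ! * suc r)
    r![r+1]≢0 = m*n≢0 (r !) (suc r) {{r !≢0}}
    rearrange : ∀ f s sᵐ k → f * (s * sᵐ) * k ≡ f * s * (k * sᵐ)
    rearrange = solve-∀
    rearrange′ : ∀ p k q → p * k * q ≡ p * q * k
    rearrange′ = solve-∀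

factOverPow<prod-witness : ∀ {m k} → k ≤ 2 + m → arrangements (suc m) * suc k ≤ (2 + m) * suc m ! →
                           factOverPow (2 + m) < prod (witness (2 + m) k) (2 + m)
factOverPow<prod-witness {m} {k} k≤r bound = begin-strict
  factOverPow r               ≡⟨⟩
  r ! ÷ r ^ r                 <⟨ ÷-mono-< {r !} {r ^ r} {∏ (gapped k) r} {suc r ^ r}
                                   (r!*[r+1]^r<∏gapped*r^r k≤r bound) ⟩
  ∏ (gapped k) r ÷ suc r ^ r  ≡⟨ prod-÷ (gapped k) (suc r) r ⟨
  prod (witness r k) r        ∎
  where
    open ℚ.≤-Reasoning
    r = 2 + m
    instance
      rʳ≢0 : NonZero (r ^ r)
      rʳ≢0 = m^n≢0 r r
      [r+1]ʳ≢0 : NonZero (suc r ^ r)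
      [r+1]ʳ≢0 = m^n≢0 (suc r) r

lemma3p10 : (r k : ℕ) → 2 ≤ r → 1 ≤ k →
              e≤ ((+ r) / suc k) →
              Σ (ℕ → ℚ) (λ x → InX r k x × factOverPow r < prod x r)
lemma3p10 (suc zero) _ (s≤s ()) _ _
lemma3p10 r@(suc (suc m)) k _ _ e≤r/[k+1] =
  witness r k , witness∈X k<r , factOverPow<prod-witness (<⇒≤ k<r) (bound (suc m))
  where
    bound : ∀ n → arrangements n * suc k ≤ r * n !
    bound = e≤÷⇒arrangements*≤ e≤r/[k+1]
    -- 2 (k+1) ≤ r, from eSum 1 = 2 ≤ r/(k+1)
    k<r : k ℕ.< r
    k<r = ≤-trans (m≤m+n (suc k) (suc k + 0)) (≤-trans (bound 1) (≤-reflexive (*-identityʳ r)))
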